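{- Let $n\ge 1$ and $N\ge M\ge 1$ be integers and let $A=\{\mathbf a_1,\dots,\mathbf a_N\}\subseteq\mathbb Z^n$, where each $\mathbf a_j$ has last coordinate $1$. Put $\beta=\sum_{j=1}^M\mathbf a_j$ and suppose $A'=\{\mathbf a_1,\dots,\mathbf a_M\}$ is minimal for $\sigma_\beta^\circ$. Let $u\in\mathcal M_\beta$ and $k\in\{1,\dots,N\}$. Then \[ \frac{\partial}{\partial\Lambda_k}F_u(\Lambda)=\begin{cases}F_{u-\mathbf a_k}(\Lambda)&\text{if }\mathbf a_k\in\sigma_\beta,\\ 0&\text{if }\mathbf a_k\notin\sigma_\beta.\end{cases}\]
   Context: $\mathbb N$ denotes the nonnegative integers. $C(A)\subseteq\mathbb R^n$ is the real cone generated by $A$. $\sigma_\beta$ is the smallest closed face of $C(A)$ containing $\beta$, and $\sigma_\beta^\circ$ its relative interior ($\sigma_\beta$ minus all its proper closed subfaces). $A'$ is minimal for $\sigma_\beta^\circ$ if for every proper subset $J\subsetneq\{1,\dots,M\}$, $\sum_{j\in J}\mathbf a_j\notin\sigma_\beta^\circ$. $\mathbb ZA$ is the subgroup of $\mathbb Z^n$ generated by $A$, $\mathcal M_\beta=(-\sigma_\beta^\circ)\cap\mathbb ZA$, and $E_\beta=\{l=(l_1,\dots,l_N)\in\mathbb N^N: l_j=0\text{ whenever }\mathbf a_j\notin\sigma_\beta\}$. For $u\in\mathcal M_\beta$, $F_u(\Lambda)$ is the formal Laurent series in $\Lambda_1,\dots,\Lambda_N$ with rational coefficients \[F_u(\Lambda)=\sum_{\substack{l\in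 E_\beta\\ \sum_{j=1}^M(-l_j-1)\mathbf a_j+\sum_{j=M+1}^N l_j\mathbf a_j=u}}(-1)^{\sum_{j=1}^M l_j}\frac{\prod_{j=1}^M l_j!}{\prod_{j=M+1}^N l_j!}\,\Lambda_1^{ -l_1-1}\cdots\Lambda_M^{ -l_M-1}\Lambda_{M+1}^{l_{M+1}}\cdots\Lambda_N^{l_N}.\] Derivatives are taken term by term. -}

module Defs where

open import Data.Nat as ℕ using (ℕ; zero; suc; _<_; _≤_; _!; NonZero)
open import Data.Nat.Properties as ℕP using (m*n≢0; _!≢0)
open import Data.Integer as ℤ using (ℤ; +_; ∣_∣)
open import Data.Integer.Properties as ℤP using ()
open import Data.Rational as ℚ using (ℚ; _/_; 0ℚ)
open import Data.Fin as Fin using (Fin; toℕ; fromℕ)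
open import Data.Fin.Properties using (all?)
open import Data.Fin.Subset using (Subset; inside; _∈_; _⊂_; ⊤)
open import Data.Fin.Subset.Properties using (_∈?_)
open import Data.Bool using (Bool; true; false; if_then_else_; not)
open import Data.Bool.Properties using () renaming (_≟_ to _≟B_)
open import Data.Product using (Σ; ∃; _×_; _,_)
open import Relation.Nullary using (¬_; Dec; yes; no; does)
open import Relation.Nullary.Decidable using (_×-dec_; _→-dec_)
open import Relation.Binary.PropositionalEquality using (_≡_)

sumℤ : ∀ {N} → (Fin N → ℤ) → ℤ
sumℤ {zero}  f = + 0
sumℤ {suc N} f = f Fin.zero ℤ.+ sumℤ (λ j → f (Fin.suc j))

sumℚ : ∀ {N} → (Fin N → ℚ) → ℚ
sumℚ {zero}  f = 0ℚ
sumℚ {suc N} f = f Fin.zero ℚ.+ sumℚ (λ j → f (Fin.suc j))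

sumℕ : ∀ {N} → (Fin N → ℕ) → ℕ
sumℕ {zero}  f = 0
sumℕ {suc N} f = f Fin.zero ℕ.+ sumℕ (λ j → f (Fin.suc j))

prodFact : ∀ {N} → (Fin N → Bool) → (Fin N → ℕ) → ℕ
prodFact {zero}  S l = 1
prodFact {suc N} S l =
  (if S Fin.zero then l Fin.zero ! else 1) ℕ.* prodFact (λ j → S (Fin.suc j)) (λ j → l (Fin.suc j))

prodFact-nonZero : ∀ {N} (S : Fin N → Bool) (l : Fin N → ℕ) → NonZero (prodFact S l)
prodFact-nonZero {zero}  S l = _
prodFact-nonZero {suc N} S l with S Fin.zero
... | true  = m*n≢0 (l Fin.zero !) _ {{l Fin.zero !≢0}} {{prodFact-nonZero (λ j → S (Fin.suc j)) (λ j → l (Fin.suc j))}}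
... | false = m*n≢0 1 _ {{_}} {{prodFact-nonZero (λ j → S (Fin.suc j)) (λ j → l (Fin.suc j))}}

Vecℤ : ℕ → Set
Vecℤ n = Fin n → ℤ

Vecℚ : ℕ → Set
Vecℚ n = Fin n → ℚ

toℚ : ℤ → ℚ
toℚ z = z / 1

toℚv : ∀ {n} → Vecℤ n → Vecℚ n
toℚv v i = toℚ (v i)

_-v_ : ∀ {n} → Vecℤ n → Vecℤ n → Vecℤ n
(u -v v) i = u i ℤ.- v i

-v_ : ∀ {n} → Vecℤ n → Vecℤ n
(-v u) i = ℤ.- u i

_·_ : ∀ {n} → Vecℚ n → Vecℚ n → ℚ
w · x = sumℚ (λ i → w i ℚ.* x i)

lastIdx : ∀ {n} → 1 ≤ n → Fin n
lastIdx {suc n} _ = fromℕ n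

-- "j is one of the first M indices", i.e. j ∈ {1,…,M} in 1-based numbering
isFirst : ∀ {N} (M : ℕ) → Fin N → Bool
isFirst M j = does (toℕ j ℕP.<? M)

betaOf : ∀ {n N} (M : ℕ) → (Fin N → Vecℤ n) → Vecℤ n
betaOf M A i = sumℤ (λ j → if isFirst M j then A j i else + 0)

-- the rational points of the real cone C(A): nonnegative combinations
-- (for rational points, membership in the real cone = membership in the rational cone)
InCone : ∀ {n N} → (Fin N → Vecℤ n) → Vecℚ n → Set
InCone {n} {N} A x = Σ (Fin N → ℚ) λ c →
  (∀ j → 0ℚ ℚ.≤ c j) × (∀ i → x i ≡ sumℚ (λ j → c j ℚ.* toℚ (A j i)))

-- w is in the dual cone: w ≥ 0 on C(A); then C(A) ∩ w^⊥ is a closed face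
-- and every closed face of C(A) arises this way.
Dual : ∀ {n N} → (Fin N → Vecℤ n) → Vecℚ n → Set
Dual A w = ∀ j → 0ℚ ℚ.≤ w · toℚv (A j)

-- x ∈ σ_β : x lies in the smallest closed face of C(A) containing β,
-- i.e. in the intersection of all closed faces C(A) ∩ w^⊥ containing β.
InSigma : ∀ {n N} → (Fin N → Vecℤ n) → Vecℤ n → Vecℚ n → Set
InSigma A β x = InCone A x × (∀ w → Dual A w → w · toℚv β ≡ 0ℚ → w · x ≡ 0ℚ)

-- x ∈ σ_β° : x ∈ σ_β and x lies in no proper closed subface of σ_β,
-- i.e. every closed face of C(A) containing x contains all of σ_β.
InSigmaInt : ∀ {n N} → (Fin N → Vecℤ n) → Vecℤ n → Vecℚ n → Set
InSigmaInt {n} A β x = InSigma A β x ×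
  (∀ w → Dual A w → w · x ≡ 0ℚ → ∀ (y : Vecℚ n) → InSigma A β y → w · y ≡ 0ℚ)

subsetSum : ∀ {n N M} → (Fin N → Vecℤ n) → Subset M → Vecℤ n
subsetSum {n} {N} {M} A J i = sumℤ {N} helper
  where
  helper : Fin N → ℤ
  helper j with toℕ j ℕP.<? M
  ... | yes j<M = if does (Fin.fromℕ< j<M ∈? J) then A j i else + 0
  ... | no  _   = + 0

MinimalFor : ∀ {n N} (M : ℕ) → (Fin N → Vecℤ n) → Set
MinimalFor {n} {N} M A =
  ∀ (J : Subset M) → J ⊂ ⊤ → ¬ InSigmaInt A (betaOf M A) (toℚv (subsetSum A J))

InZA : ∀ {n N} → (Fin N → Vecℤ n) → Vecℤ n → Set
InZA {n} {N} A u = Σ (Fin N → ℤ) λ c → ∀ i → u i ≡ sumℤ (λ j → c j ℤ.* A j i)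

InMβ : ∀ {n N} (M : ℕ) → (Fin N → Vecℤ n) → Vecℤ n → Set
InMβ M A u = InZA A u × InSigmaInt A (betaOf M A) (toℚv (-v u))

-- Formal Laurent series in Λ_1..Λ_N with rational coefficients:
-- a series is its coefficient function  (exponent vector ∈ ℤ^N) ↦ ℚ.

Series : ℕ → Set
Series N = (Fin N → ℤ) → ℚ

bump : ∀ {N} → Fin N → (Fin N → ℤ) → (Fin N → ℤ)
bump k e j = if does (j Fin.≟ k) then e j ℤ.+ + 1 else e j

-- term-by-term derivative ∂/∂Λ_k :  c Λ^{e'} ↦ c e'_k Λ^{e' - δ_k},
-- so the coefficient of Λ^e in ∂_k F is (e_k + 1) · [Λ^{e+δ_k}] F
deriv : ∀ {N} → Fin N → Series N → Series N
deriv k F e = toℚ (e k ℤ.+ + 1) ℚ.* F (bump k e)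

zeroS : ∀ {N} → Series N
zeroS e = 0ℚ

-- For a monomial Λ^e, the only candidate l with
-- Λ_1^{-l_1-1}⋯Λ_M^{-l_M-1}Λ_{M+1}^{l_{M+1}}⋯Λ_N^{l_N} = Λ^e  is
-- l_j = -e_j - 1 (j ≤ M),  l_j = e_j (j > M).
lCand : ∀ {N} (M : ℕ) → (Fin N → ℤ) → Fin N → ℤ
lCand M e j = if isFirst M j then ℤ.- e j ℤ.- + 1 else e j

lNat : ∀ {N} (M : ℕ) → (Fin N → ℤ) → Fin N → ℕ
lNat M e j = ∣ lCand M e j ∣

lComb : ∀ {n N} (M : ℕ) → (Fin N → Vecℤ n) → (Fin N → ℕ) → Vecℤ n
lComb M A l i = sumℤ (λ j → (if isFirst M j then ℤ.- (+ l j) ℤ.- + 1 else + l j) ℤ.* A j i)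

termCoef : ∀ {N} (M : ℕ) → (Fin N → ℕ) → ℚ
termCoef M l =
  ((ℤ.- + 1) ℤ.^ sumℕ (λ j → if isFirst M j then l j else 0) ℤ.* + prodFact (isFirst M) l)
    / prodFact (λ j → not (isFirst M j)) l
  where instance _ = prodFact-nonZero (λ j → not (isFirst M j)) l

-- F_u.  `inσ j` decides whether a_j ∈ σ_β (used to define E_β).
-- Coefficient of Λ^e: the term for l = lNat M e if that l is a genuine element
-- of ℕ^N (lCand ≥ 0), lies in E_β and satisfies the exponent equation; else 0.
FSeries : ∀ {n N} (M : ℕ) (A : Fin N → Vecℤ n)
  (inσ : ∀ j → Dec (InSigma A (betaOf M A) (toℚv (A j)))) → Vecℤ n → Series N
FSeries {n} {N} M A inσ u e with
     all? (λ j → + 0 ℤ.≤? lCand M e j)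
  ×-dec all? (λ j → (does (inσ j) ≟B false) →-dec (lNat M e j ℕP.≟ 0))
  ×-dec all? (λ i → lComb M A (lNat M e) i ℤP.≟ u i)
... | yes _ = termCoef M (lNat M e)
... | no  _ = 0ℚ

module Submission where

-- The coefficient of Λ^e in F_u comes from the unique candidate l = lCand e: it is the closed-form
-- term when l ∈ ℕ^N ∩ E_β and Σ_j e_j a_j = u (for such e the exponent combination of l is exactly
-- Σ_j e_j a_j), and 0 otherwise. Since ∂_k sends Λ^(e+δ_k) to (e_k + 1) Λ^e and
-- Σ_j (e + δ_k)_j a_j = a_k + Σ_j e_j a_j, the term of ∂_k F_u at e matches the term of F_{u−a_k} at e,
-- and e_k + 1 is exactly the ratio of the two coefficients: with l the index of the term of
-- F_{u−a_k}, it is −l_k for k ≤ M (from (−1)^{l_k} l_k!) and l_k + 1 for k > M (from 1/l_k!).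
-- What remains are boundary terms. Exponents with a negative l_k contribute to neither side; if
-- a_k ∉ σ_β then E_β forces l_k = 0, which kills ∂_k F_u. For k ≤ M a term of F_{u−a_k} with l_k = 0
-- would write u as a combination in which a_k is missing and the a_j with j > M have nonnegative
-- coefficients; then every face containing Σ_{j ≤ M, j ≠ k} a_j also contains −u, which puts this
-- proper subsum into σ_β° and contradicts the minimality of A′.

open import Defs

open import Algebra.Bundles using (CommutativeMonoid)
import Algebra.Properties.CommutativeMonoid.Sum as MonoidSum
open import Data.Bool using (Bool; true; false; if_then_else_; not; _∧_)
open import Data.Bool.Properties using (T-≡) renaming (_≟_ to _≟B_)
open import Data.Empty using (⊥; ⊥-elim)
open import Data.Fin as Fin using (Fin; toℕ)
import Data.Fin.Properties as FinP
open import Data.Fin.Subset using (Subset; ∁; ⁅_⁆; ⊤; _⊂_)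
open import Data.Fin.Subset.Properties using (_∈?_; ∈⊤; x∈⁅x⁆; x∈⁅y⁆⇒x≡y; x∈∁p⇒x∉p; x∉p⇒x∈∁p)
open import Data.Integer as ℤ using (ℤ; +_; -[1+_]; +≤+)
import Data.Integer.Properties as ℤP
open import Data.Integer.Tactic.RingSolver using (solve-∀)
open import Data.Nat as ℕ using (ℕ; zero; suc; _≤_; _!; NonZero)
import Data.Nat.Properties as ℕP
open import Data.Product using (_×_; _,_; proj₁)
open import Data.Rational as ℚ using (ℚ; 0ℚ; _/_)
import Data.Rational.Properties as ℚP
open import Data.Rational.Unnormalised as ℚᵘ using (mkℚᵘ; *≡*)
import Data.Rational.Unnormalised.Properties as ℚᵘP
open import Data.Sum using (_⊎_; inj₁; inj₂)
open import Function using (_∘_)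
open import Function.Bundles using (Equivalence; _⇔_; mk⇔)
open import Relation.Nullary using (¬_; Dec; yes; no; does)
open import Relation.Nullary.Decidable using (dec-true; dec-false; _×-dec_; _→-dec_)
open import Relation.Binary.PropositionalEquality
  using (_≡_; _≢_; refl; sym; trans; cong; cong₂; subst; module ≡-Reasoning)

open import Algebra.Properties.AbelianGroup ℤP.+-0-abelianGroup using (xyx⁻¹≈y)
open import Algebra.Properties.CommutativeSemigroup
  (CommutativeMonoid.commutativeSemigroup ℚP.+-0-commutativeMonoid) using (interchange)
open import Algebra.Properties.CommutativeSemigroup
  (CommutativeMonoid.commutativeSemigroup ℚP.*-1-commutativeMonoid) using (x∙yz≈y∙xz)

module _ {c ℓ} (C : CommutativeMonoid c ℓ) where
  open CommutativeMonoid C using (Carrier; _≈_; _∙_; ∙-cong; ∙-congˡ; assoc; setoid)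
  open MonoidSum C using (sum; sum-remove; sum-cong-≋)
  open import Relation.Binary.Reasoning.Setoid setoid

  sum-update : ∀ {N} (k : Fin N) {f g : Fin N → Carrier} x →
               (∀ j → j ≢ k → f j ≈ g j) → f k ≈ x ∙ g k → sum f ≈ x ∙ sum g
  sum-update {suc N} k {f} {g} x f≈g fk≈ = begin
    sum f                                  ≈⟨ sum-remove {i = k} f ⟩
    f k ∙ sum (f ∘ Fin.punchIn k)          ≈⟨ ∙-cong fk≈ (sum-cong-≋ λ j → f≈g _ (FinP.punchInᵢ≢i k j)) ⟩
    (x ∙ g k) ∙ sum (g ∘ Fin.punchIn k)    ≈⟨ assoc x (g k) _ ⟩
    x ∙ (g k ∙ sum (g ∘ Fin.punchIn k))    ≈⟨ ∙-congˡ (sum-remove {i = k} g) ⟨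
    x ∙ sum g                              ∎

sumℤ≡sum : ∀ {N} (f : Fin N → ℤ) → sumℤ f ≡ MonoidSum.sum ℤP.+-0-commutativeMonoid f
sumℤ≡sum {zero}  f = refl
sumℤ≡sum {suc N} f = cong (ℤ._+_ (f Fin.zero)) (sumℤ≡sum (f ∘ Fin.suc))

sumℕ≡sum : ∀ {N} (f : Fin N → ℕ) → sumℕ f ≡ MonoidSum.sum ℕP.+-0-commutativeMonoid f
sumℕ≡sum {zero}  f = refl
sumℕ≡sum {suc N} f = cong (ℕ._+_ (f Fin.zero)) (sumℕ≡sum (f ∘ Fin.suc))

prodFact≡product : ∀ {N} (S : Fin N → Bool) (l : Fin N → ℕ) →
                   prodFact S l ≡ MonoidSum.sum ℕP.*-1-commutativeMonoid (λ j → if S j then l j ! else 1)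
prodFact≡product {zero}  S l = refl
prodFact≡product {suc N} S l =
  cong (ℕ._*_ (if S Fin.zero then l Fin.zero ! else 1)) (prodFact≡product (S ∘ Fin.suc) (l ∘ Fin.suc))

sumℤ-update : ∀ {N} (k : Fin N) {f g : Fin N → ℤ} x →
              (∀ j → j ≢ k → f j ≡ g j) → f k ≡ x ℤ.+ g k → sumℤ f ≡ x ℤ.+ sumℤ g
sumℤ-update k {f} {g} x f≡g fk≡ =
  trans (sumℤ≡sum f)
    (trans (sum-update ℤP.+-0-commutativeMonoid k x f≡g fk≡) (cong (ℤ._+_ x) (sym (sumℤ≡sum g))))

sumℕ-update : ∀ {N} (k : Fin N) {f g : Fin N → ℕ} x →
              (∀ j → j ≢ k → f j ≡ g j) → f k ≡ x ℕ.+ g k → sumℕ f ≡ x ℕ.+ sumℕ g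
sumℕ-update k {f} {g} x f≡g fk≡ =
  trans (sumℕ≡sum f)
    (trans (sum-update ℕP.+-0-commutativeMonoid k x f≡g fk≡) (cong (ℕ._+_ x) (sym (sumℕ≡sum g))))

prodFact-update : ∀ {N} (k : Fin N) (S : Fin N → Bool) {l l′ : Fin N → ℕ} x →
                  (∀ j → j ≢ k → l′ j ≡ l j) →
                  (if S k then l′ k ! else 1) ≡ x ℕ.* (if S k then l k ! else 1) →
                  prodFact S l′ ≡ x ℕ.* prodFact S l
prodFact-update k S {l} {l′} x l′≡l at-k =
  trans (prodFact≡product S l′)
    (trans (sum-update ℕP.*-1-commutativeMonoid k x (λ j j≢k → cong (λ m → if S j then m ! else 1) (l′≡l j j≢k)) at-k)
      (cong (ℕ._*_ x) (sym (prodFact≡product S l))))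

sumℤ-cong : ∀ {N} {f g : Fin N → ℤ} → (∀ j → f j ≡ g j) → sumℤ f ≡ sumℤ g
sumℤ-cong {zero}  f≡g = refl
sumℤ-cong {suc N} f≡g = cong₂ ℤ._+_ (f≡g Fin.zero) (sumℤ-cong (f≡g ∘ Fin.suc))

sumℤ-zero : ∀ N → sumℤ {N} (λ _ → + 0) ≡ + 0
sumℤ-zero N = trans (sumℤ≡sum {N} (λ _ → + 0)) (MonoidSum.sum-replicate-zero ℤP.+-0-commutativeMonoid N)

sumℤ-neg : ∀ {N} (f : Fin N → ℤ) → sumℤ (λ j → ℤ.- f j) ≡ ℤ.- sumℤ f
sumℤ-neg {zero}  f = refl
sumℤ-neg {suc N} f =
  trans (cong (ℤ._+_ (ℤ.- f Fin.zero)) (sumℤ-neg (f ∘ Fin.suc))) (sym (ℤP.neg-distrib-+ (f Fin.zero) _))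

sumℚ-cong : ∀ {N} {f g : Fin N → ℚ} → (∀ j → f j ≡ g j) → sumℚ f ≡ sumℚ g
sumℚ-cong {zero}  f≡g = refl
sumℚ-cong {suc N} f≡g = cong₂ ℚ._+_ (f≡g Fin.zero) (sumℚ-cong (f≡g ∘ Fin.suc))

sumℚ-zero : ∀ N → sumℚ {N} (λ _ → 0ℚ) ≡ 0ℚ
sumℚ-zero zero    = refl
sumℚ-zero (suc N) = cong (ℚ._+_ 0ℚ) (sumℚ-zero N)

sumℚ-+ : ∀ {N} (f g : Fin N → ℚ) → sumℚ (λ j → f j ℚ.+ g j) ≡ sumℚ f ℚ.+ sumℚ g
sumℚ-+ {zero}  f g = refl
sumℚ-+ {suc N} f g =
  trans (cong (ℚ._+_ (f Fin.zero ℚ.+ g Fin.zero)) (sumℚ-+ (f ∘ Fin.suc) (g ∘ Fin.suc)))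
        (interchange (f Fin.zero) (g Fin.zero) _ _)

sumℚ-*ˡ : ∀ {N} c (f : Fin N → ℚ) → sumℚ (λ j → c ℚ.* f j) ≡ c ℚ.* sumℚ f
sumℚ-*ˡ {zero}  c f = sym (ℚP.*-zeroʳ c)
sumℚ-*ˡ {suc N} c f =
  trans (cong (ℚ._+_ (c ℚ.* f Fin.zero)) (sumℚ-*ˡ c (f ∘ Fin.suc))) (sym (ℚP.*-distribˡ-+ c (f Fin.zero) _))

sumℚ-swap : ∀ {m N} (f : Fin m → Fin N → ℚ) →
            sumℚ (λ i → sumℚ (λ j → f i j)) ≡ sumℚ (λ j → sumℚ (λ i → f i j))
sumℚ-swap {zero}  {N} f = sym (sumℚ-zero N)
sumℚ-swap {suc m}     f =
  trans (cong (ℚ._+_ (sumℚ (f Fin.zero))) (sumℚ-swap (f ∘ Fin.suc)))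
        (sym (sumℚ-+ (f Fin.zero) (λ j → sumℚ (λ i → f (Fin.suc i) j))))

sumℚ-nonneg : ∀ {N} (f : Fin N → ℚ) → (∀ j → 0ℚ ℚ.≤ f j) → 0ℚ ℚ.≤ sumℚ f
sumℚ-nonneg {zero}  f 0≤f = ℚP.≤-refl
sumℚ-nonneg {suc N} f 0≤f = ℚP.+-mono-≤ (0≤f Fin.zero) (sumℚ-nonneg (f ∘ Fin.suc) (0≤f ∘ Fin.suc))

sumℚ-nonpos : ∀ {N} (f : Fin N → ℚ) → (∀ j → f j ℚ.≤ 0ℚ) → sumℚ f ℚ.≤ 0ℚ
sumℚ-nonpos {zero}  f f≤0 = ℚP.≤-refl
sumℚ-nonpos {suc N} f f≤0 = ℚP.+-mono-≤ (f≤0 Fin.zero) (sumℚ-nonpos (f ∘ Fin.suc) (f≤0 ∘ Fin.suc))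

p+q≡0⇒p≡0 : ∀ {p q} → 0ℚ ℚ.≤ p → 0ℚ ℚ.≤ q → p ℚ.+ q ≡ 0ℚ → p ≡ 0ℚ
p+q≡0⇒p≡0 {p} {q} 0≤p 0≤q p+q≡0 =
  ℚP.≤-antisym (subst (p ℚ.≤_) p+q≡0 (subst (ℚ._≤ p ℚ.+ q) (ℚP.+-identityʳ p) (ℚP.+-monoʳ-≤ p 0≤q))) 0≤p

sumℚ≡0⇒≡0 : ∀ {N} (f : Fin N → ℚ) → (∀ j → 0ℚ ℚ.≤ f j) → sumℚ f ≡ 0ℚ → ∀ j → f j ≡ 0ℚ
sumℚ≡0⇒≡0 {suc N} f 0≤f Σ≡0 Fin.zero    =
  p+q≡0⇒p≡0 (0≤f Fin.zero) (sumℚ-nonneg (f ∘ Fin.suc) (0≤f ∘ Fin.suc)) Σ≡0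
sumℚ≡0⇒≡0 {suc N} f 0≤f Σ≡0 (Fin.suc j) =
  sumℚ≡0⇒≡0 (f ∘ Fin.suc) (0≤f ∘ Fin.suc)
    (p+q≡0⇒p≡0 (sumℚ-nonneg (f ∘ Fin.suc) (0≤f ∘ Fin.suc)) (0≤f Fin.zero)
      (trans (ℚP.+-comm _ (f Fin.zero)) Σ≡0)) j

0≤+ : ∀ {z m} → z ≡ + m → + 0 ℤ.≤ z
0≤+ refl = +≤+ ℕ.z≤n

a+[x-a]≡x : ∀ a x → a ℤ.+ (x ℤ.- a) ≡ x
a+[x-a]≡x = solve-∀

toℚᵘ-toℚ : ∀ z → ℚ.toℚᵘ (toℚ z) ℚᵘ.≃ mkℚᵘ z 0
toℚᵘ-toℚ z = ℚP.toℚᵘ-fromℚᵘ (mkℚᵘ z 0)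

toℚ-+ : ∀ a b → toℚ (a ℤ.+ b) ≡ toℚ a ℚ.+ toℚ b
toℚ-+ a b = ℚP.toℚᵘ-injective (begin
  ℚ.toℚᵘ (toℚ (a ℤ.+ b))                ≈⟨ toℚᵘ-toℚ (a ℤ.+ b) ⟩
  mkℚᵘ (a ℤ.+ b) 0                       ≈⟨ *≡* (cross a b) ⟩
  mkℚᵘ a 0 ℚᵘ.+ mkℚᵘ b 0                 ≈⟨ ℚᵘP.+-cong (toℚᵘ-toℚ a) (toℚᵘ-toℚ b) ⟨
  ℚ.toℚᵘ (toℚ a) ℚᵘ.+ ℚ.toℚᵘ (toℚ b)     ≈⟨ ℚP.toℚᵘ-homo-+ (toℚ a) (toℚ b) ⟨
  ℚ.toℚᵘ (toℚ a ℚ.+ toℚ b)               ∎)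
  where
  open import Relation.Binary.Reasoning.Setoid ℚᵘP.≃-setoid
  cross : ∀ a b → (a ℤ.+ b) ℤ.* + 1 ≡ (a ℤ.* + 1 ℤ.+ b ℤ.* + 1) ℤ.* + 1
  cross = solve-∀

toℚ-neg : ∀ a → toℚ (ℤ.- a) ≡ ℚ.- toℚ a
toℚ-neg a = ℚP.toℚᵘ-injective (begin
  ℚ.toℚᵘ (toℚ (ℤ.- a))    ≈⟨ toℚᵘ-toℚ (ℤ.- a) ⟩
  ℚᵘ.- mkℚᵘ a 0           ≈⟨ ℚᵘP.-‿cong (toℚᵘ-toℚ a) ⟨
  ℚᵘ.- ℚ.toℚᵘ (toℚ a)     ≈⟨ ℚP.toℚᵘ-homo‿- (toℚ a) ⟨
  ℚ.toℚᵘ (ℚ.- toℚ a)      ∎)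
  where open import Relation.Binary.Reasoning.Setoid ℚᵘP.≃-setoid

/-scale : ∀ c x x′ D D′ .{{_ : NonZero D}} .{{_ : NonZero D′}} →
          x ℤ.* + D′ ≡ (c ℤ.* x′) ℤ.* + D → x / D ≡ toℚ c ℚ.* (x′ / D′)
/-scale c x x′ (suc d) (suc d′) cross = ℚP.toℚᵘ-injective (begin
  ℚ.toℚᵘ (x / suc d)                          ≈⟨ ℚP.toℚᵘ-fromℚᵘ (mkℚᵘ x d) ⟩
  mkℚᵘ x d                                    ≈⟨ *≡* (trans (cong (λ m → x ℤ.* + suc m) (ℕP.+-identityʳ d′)) cross) ⟩
  mkℚᵘ c 0 ℚᵘ.* mkℚᵘ x′ d′                    ≈⟨ ℚᵘP.*-cong (toℚᵘ-toℚ c) (ℚP.toℚᵘ-fromℚᵘ (mkℚᵘ x′ d′)) ⟨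
  ℚ.toℚᵘ (toℚ c) ℚᵘ.* ℚ.toℚᵘ (x′ / suc d′)    ≈⟨ ℚP.toℚᵘ-homo-* (toℚ c) (x′ / suc d′) ⟨
  ℚ.toℚᵘ (toℚ c ℚ.* (x′ / suc d′))            ∎)
  where open import Relation.Binary.Reasoning.Setoid ℚᵘP.≃-setoid

toℚ-* : ∀ a b → toℚ (a ℤ.* b) ≡ toℚ a ℚ.* toℚ b
toℚ-* a b = /-scale a (a ℤ.* b) b 1 1 refl

toℚ-sum : ∀ {N} (f : Fin N → ℤ) → toℚ (sumℤ f) ≡ sumℚ (λ j → toℚ (f j))
toℚ-sum {zero}  f = refl
toℚ-sum {suc N} f = trans (toℚ-+ (f Fin.zero) _) (cong (ℚ._+_ (toℚ (f Fin.zero))) (toℚ-sum (f ∘ Fin.suc)))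

toℚ-nonneg : ∀ {z} → + 0 ℤ.≤ z → 0ℚ ℚ.≤ toℚ z
toℚ-nonneg {+ m} _ = ℚP.nonNegative⁻¹ _ {{ℚP.normalize-nonNeg m 1}}

*-nonneg : ∀ {p q} → 0ℚ ℚ.≤ p → 0ℚ ℚ.≤ q → 0ℚ ℚ.≤ p ℚ.* q
*-nonneg {p} {q} 0≤p 0≤q =
  ℚP.nonNegative⁻¹ _ {{ℚP.nonNeg*nonNeg⇒nonNeg p {{ℚ.nonNegative 0≤p}} q {{ℚ.nonNegative 0≤q}}}}

toℚ-neg-*-nonpos : ∀ {z q} → + 0 ℤ.≤ z → 0ℚ ℚ.≤ q → toℚ (ℤ.- z) ℚ.* q ℚ.≤ 0ℚ
toℚ-neg-*-nonpos {z} {q} 0≤z 0≤q =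
  subst (ℚ._≤ 0ℚ) (trans (ℚP.neg-distribˡ-* (toℚ z) q) (cong (ℚ._* q) (sym (toℚ-neg z))))
    (ℚP.neg-antimono-≤ (*-nonneg (toℚ-nonneg 0≤z) 0≤q))

bump-≡ : ∀ {N} (k : Fin N) (e : Fin N → ℤ) → bump k e k ≡ e k ℤ.+ + 1
bump-≡ k e = cong (λ b → if b then e k ℤ.+ + 1 else e k) (dec-true (k Fin.≟ k) refl)

bump-≢ : ∀ {N} {j k : Fin N} (e : Fin N → ℤ) → j ≢ k → bump k e j ≡ e j
bump-≢ {j = j} {k} e j≢k = cong (λ b → if b then e j ℤ.+ + 1 else e j) (dec-false (j Fin.≟ k) j≢k)

module Cone {n N : ℕ} (A : Fin N → Vecℤ n) where

  Combination : (Fin N → ℤ) → Vecℤ n → Set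
  Combination c x = ∀ i → x i ≡ sumℤ (λ j → c j ℤ.* A j i)

  combination-bump : ∀ k c {x} → Combination c x → Combination (bump k c) (λ i → A k i ℤ.+ x i)
  combination-bump k c x≡ i =
    trans (cong (ℤ._+_ (A k i)) (x≡ i)) (sym (sumℤ-update k (A k i)
      (λ j j≢k → cong (ℤ._* A j i) (bump-≢ c j≢k))
      (trans (cong (ℤ._* A k i) (trans (bump-≡ k c) (ℤP.+-comm (c k) (+ 1)))) (ℤP.suc-* (c k) (A k i)))))

  combination-neg : ∀ c {x} → Combination c x → Combination (λ j → ℤ.- c j) (-v x)
  combination-neg c x≡ i = trans (cong ℤ.-_ (x≡ i))
    (trans (sym (sumℤ-neg (λ j → c j ℤ.* A j i))) (sumℤ-cong (λ j → ℤP.neg-distribˡ-* (c j) (A j i))))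

  toℚv-combination : ∀ c {x} → Combination c x → ∀ i → toℚv x i ≡ sumℚ (λ j → toℚ (c j) ℚ.* toℚ (A j i))
  toℚv-combination c x≡ i =
    trans (cong toℚ (x≡ i)) (trans (toℚ-sum (λ j → c j ℤ.* A j i)) (sumℚ-cong (λ j → toℚ-* (c j) (A j i))))

  ·-linear : ∀ w {x} (c : Fin N → ℚ) → (∀ i → x i ≡ sumℚ (λ j → c j ℚ.* toℚ (A j i))) →
             w · x ≡ sumℚ (λ j → c j ℚ.* (w · toℚv (A j)))
  ·-linear w {x} c x≡ = begin
    sumℚ (λ i → w i ℚ.* x i)
      ≡⟨ sumℚ-cong (λ i → cong (w i ℚ.*_) (x≡ i)) ⟩
    sumℚ (λ i → w i ℚ.* sumℚ (λ j → c j ℚ.* a j i))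
      ≡⟨ sumℚ-cong (λ i → sumℚ-*ˡ (w i) (λ j → c j ℚ.* a j i)) ⟨
    sumℚ (λ i → sumℚ (λ j → w i ℚ.* (c j ℚ.* a j i)))
      ≡⟨ sumℚ-swap (λ i j → w i ℚ.* (c j ℚ.* a j i)) ⟩
    sumℚ (λ j → sumℚ (λ i → w i ℚ.* (c j ℚ.* a j i)))
      ≡⟨ sumℚ-cong (λ j → sumℚ-cong (λ i → x∙yz≈y∙xz (w i) (c j) (a j i))) ⟩
    sumℚ (λ j → sumℚ (λ i → c j ℚ.* (w i ℚ.* a j i)))
      ≡⟨ sumℚ-cong (λ j → sumℚ-*ˡ (c j) (λ i → w i ℚ.* a j i)) ⟩
    sumℚ (λ j → c j ℚ.* (w · toℚv (A j)))
      ∎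
    where
    open ≡-Reasoning
    a : Fin N → Fin n → ℚ
    a j = toℚv (A j)

  ·-combination : ∀ w c {x} → Combination c x → w · toℚv x ≡ sumℚ (λ j → toℚ (c j) ℚ.* (w · toℚv (A j)))
  ·-combination w c x≡ = ·-linear w (toℚ ∘ c) (toℚv-combination c x≡)

  Dual⇒0≤· : ∀ w {x} → Dual A w → InCone A x → 0ℚ ℚ.≤ w · x
  Dual⇒0≤· w dual (c , 0≤c , x≡) =
    subst (0ℚ ℚ.≤_) (sym (·-linear w c x≡)) (sumℚ-nonneg _ (λ j → *-nonneg (0≤c j) (dual j)))

  combination-inCone : ∀ c {x} → (∀ j → + 0 ℤ.≤ c j) → Combination c x → InCone A (toℚv x)
  combination-inCone c 0≤c x≡ = toℚ ∘ c , toℚ-nonneg ∘ 0≤c , toℚv-combination c x≡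

  Dual⇒·≡0⇒summand-·≡0 : ∀ w c {x} → Dual A w → (∀ j → + 0 ℤ.≤ c j) → Combination c x →
                          w · toℚv x ≡ 0ℚ → ∀ j → c j ≡ + 1 → w · toℚv (A j) ≡ 0ℚ
  Dual⇒·≡0⇒summand-·≡0 w c dual 0≤c x≡ w·x≡0 j cⱼ≡1 =
    trans (sym (ℚP.*-identityˡ _)) (subst (λ z → toℚ z ℚ.* (w · toℚv (A j)) ≡ 0ℚ) cⱼ≡1
      (sumℚ≡0⇒≡0 (λ j → toℚ (c j) ℚ.* (w · toℚv (A j))) (λ j → *-nonneg (toℚ-nonneg (0≤c j)) (dual j))
        (trans (sym (·-combination w c x≡)) w·x≡0) j))

  InSigmaInt-dominated : ∀ {β s x} → InSigma A β s → InSigmaInt A β x →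
                         (∀ w → Dual A w → w · s ≡ 0ℚ → w · x ℚ.≤ 0ℚ) → InSigmaInt A β s
  InSigmaInt-dominated s∈σ (x∈σ , x-interior) dominated = s∈σ , λ w dual w·s≡0 →
    x-interior w dual (ℚP.≤-antisym (dominated w dual w·s≡0) (Dual⇒0≤· w dual (proj₁ x∈σ)))

module Face {n N : ℕ} (M : ℕ) (A : Fin N → Vecℤ n) where
  open Cone A

  β : Vecℤ n
  β = betaOf M A

  indicator : Bool → ℤ
  indicator b = if b then + 1 else + 0

  0≤indicator : ∀ b → + 0 ℤ.≤ indicator b
  0≤indicator true  = +≤+ ℕ.z≤n
  0≤indicator false = +≤+ ℕ.z≤n

  if≡indicator* : ∀ b x → (if b then x else + 0) ≡ indicator b ℤ.* x
  if≡indicator* true  x = sym (ℤP.*-identityˡ x)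
  if≡indicator* false x = refl

  β-combination : Combination (indicator ∘ isFirst M) β
  β-combination i = sumℤ-cong (λ j → if≡indicator* (isFirst M j) (A j i))

  ·β≡0⇒·first≡0 : ∀ w → Dual A w → w · toℚv β ≡ 0ℚ → ∀ j → isFirst M j ≡ true → w · toℚv (A j) ≡ 0ℚ
  ·β≡0⇒·first≡0 w dual w·β≡0 j fj =
    Dual⇒·≡0⇒summand-·≡0 w _ dual (0≤indicator ∘ isFirst M) β-combination w·β≡0 j (cong indicator fj)

  combination-inSigma : ∀ c {x} → (∀ j → + 0 ℤ.≤ c j) → (∀ j → isFirst M j ≡ false → c j ≡ + 0) →
                        Combination c x → InSigma A β (toℚv x)
  combination-inSigma c 0≤c c-rest x≡ = combination-inCone c 0≤c x≡ , λ w dual w·β≡0 →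
    trans (·-combination w c x≡) (trans (sumℚ-cong (summand≡0 w dual w·β≡0)) (sumℚ-zero N))
    where
    summand≡0 : ∀ w → Dual A w → w · toℚv β ≡ 0ℚ → ∀ j → toℚ (c j) ℚ.* (w · toℚv (A j)) ≡ 0ℚ
    summand≡0 w dual w·β≡0 j with isFirst M j in fj
    ... | true  = trans (cong (toℚ (c j) ℚ.*_) (·β≡0⇒·first≡0 w dual w·β≡0 j fj)) (ℚP.*-zeroʳ (toℚ (c j)))
    ... | false = trans (cong (λ z → toℚ z ℚ.* (w · toℚv (A j))) (c-rest j fj)) (ℚP.*-zeroˡ (w · toℚv (A j)))

  rest≢first : ∀ {j k : Fin N} → isFirst M j ≡ false → isFirst M k ≡ true → j ≢ k
  rest≢first fj fk refl with trans (sym fj) fk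
  ... | ()

  first-inSigma : ∀ {k : Fin N} → isFirst M k ≡ true → InSigma A β (toℚv (A k))
  first-inSigma {k} fk = combination-inSigma δ 0≤δ δ-rest aₖ≡
    where
    δ : Fin N → ℤ
    δ = bump k (λ _ → + 0)
    0≤δ : ∀ j → + 0 ℤ.≤ δ j
    0≤δ j with j Fin.≟ k
    ... | yes _ = +≤+ ℕ.z≤n
    ... | no  _ = +≤+ ℕ.z≤n
    δ-rest : ∀ j → isFirst M j ≡ false → δ j ≡ + 0
    δ-rest j fj = bump-≢ (λ _ → + 0) (rest≢first fj fk)
    aₖ≡ : Combination δ (A k)
    aₖ≡ i = trans (sym (ℤP.+-identityʳ (A k i))) (combination-bump k (λ _ → + 0) (λ _ → sym (sumℤ-zero N)) i)

  isFirst⇒< : ∀ {j : Fin N} → isFirst M j ≡ true → toℕ j ℕ.< M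
  isFirst⇒< {j} fj = ℕP.<ᵇ⇒< (toℕ j) M (Equivalence.from T-≡ fj)

  ∈?∁⁅⁆ : ∀ {j k : Fin N} (j<M : toℕ j ℕ.< M) (k<M : toℕ k ℕ.< M) →
          does (Fin.fromℕ< j<M ∈? ∁ ⁅ Fin.fromℕ< k<M ⁆) ≡ not (does (j Fin.≟ k))
  ∈?∁⁅⁆ {j} {k} j<M k<M with j Fin.≟ k
  ... | yes refl = dec-false (Fin.fromℕ< j<M ∈? ∁ ⁅ Fin.fromℕ< k<M ⁆) (λ x∈ → x∈∁p⇒x∉p x∈ (x∈⁅x⁆ _))
  ... | no  j≢k  = dec-true (Fin.fromℕ< j<M ∈? ∁ ⁅ Fin.fromℕ< k<M ⁆) (x∉p⇒x∈∁p (λ x∈ →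
                     j≢k (FinP.toℕ-injective (FinP.fromℕ<-injective _ _ j<M k<M (x∈⁅y⁆⇒x≡y _ x∈)))))

  ∁⁅⁆⊂⊤ : ∀ (x : Fin M) → ∁ ⁅ x ⁆ ⊂ ⊤
  ∁⁅⁆⊂⊤ x = (λ _ → ∈⊤) , x , ∈⊤ , (λ x∈ → x∈∁p⇒x∉p x∈ (x∈⁅x⁆ x))

  allFirstBut : Fin N → Fin N → Bool
  allFirstBut k j = isFirst M j ∧ not (does (j Fin.≟ k))

  module _ {k : Fin N} (k<M : toℕ k ℕ.< M) where
    mutual
      subsetSum-allFirstBut : Combination (indicator ∘ allFirstBut k) (subsetSum A (∁ ⁅ Fin.fromℕ< k<M ⁆))
      subsetSum-allFirstBut i = sumℤ-cong (summand i)

      -- The left-hand side is the summand local to subsetSum, which has no name outside Defs;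
      -- Agda infers it from the use above.
      summand : ∀ i j → _ ≡ indicator (allFirstBut k j) ℤ.* A j i
      summand i j with toℕ j ℕP.<? M in j<M?
      ... | yes j<M = trans (cong (λ b → if b then A j i else + 0) (∈?∁⁅⁆ j<M k<M))
                        (trans (if≡indicator* (not (does (j Fin.≟ k))) (A j i))
                          (cong (λ b → indicator (b ∧ not (does (j Fin.≟ k))) ℤ.* A j i) (sym (cong does j<M?))))
      ... | no  _   = cong (λ b → indicator (b ∧ not (does (j Fin.≟ k))) ℤ.* A j i) (sym (cong does j<M?))

  -- A term of F_{u−a_k} with l_k = 0 would give such a c. Every dual vector vanishing on the proper
  -- subsum s = Σ_{j ≤ M, j ≠ k} a_j is then ≥ 0 on u, so s inherits interiority from −u.
  minimal⇒¬combination : ∀ {u k} c → MinimalFor M A → InSigmaInt A β (toℚv (-v u)) → isFirst M k ≡ true →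
                         Combination c u → c k ≡ + 0 → (∀ j → isFirst M j ≡ false → + 0 ℤ.≤ c j) → ⊥
  minimal⇒¬combination {u} {k} c minimal -u∈σ° fk u≡ cₖ≡0 0≤c-rest =
    minimal J (∁⁅⁆⊂⊤ _) (InSigmaInt-dominated {β} s∈σ -u∈σ° dominated)
    where
    k<M : toℕ k ℕ.< M
    k<M = isFirst⇒< fk
    J : Subset M
    J = ∁ ⁅ Fin.fromℕ< k<M ⁆
    χ : Fin N → ℤ
    χ = indicator ∘ allFirstBut k
    0≤χ : ∀ j → + 0 ℤ.≤ χ j
    0≤χ = 0≤indicator ∘ allFirstBut k
    s∈σ : InSigma A β (toℚv (subsetSum A J))
    s∈σ = combination-inSigma χ 0≤χ (λ j fj → cong (λ b → indicator (b ∧ not (does (j Fin.≟ k)))) fj)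
            (subsetSum-allFirstBut k<M)
    dominated : ∀ w → Dual A w → w · toℚv (subsetSum A J) ≡ 0ℚ → w · toℚv (-v u) ℚ.≤ 0ℚ
    dominated w dual w·s≡0 =
      subst (ℚ._≤ 0ℚ) (sym (·-combination w (λ j → ℤ.- c j) (combination-neg c u≡))) (sumℚ-nonpos _ summand≤0)
      where
      summand≤0 : ∀ j → toℚ (ℤ.- c j) ℚ.* (w · toℚv (A j)) ℚ.≤ 0ℚ
      summand≤0 j with j Fin.≟ k | isFirst M j in fj
      ... | yes refl | _     = ℚP.≤-reflexive (trans (cong (λ z → toℚ (ℤ.- z) ℚ.* (w · toℚv (A j))) cₖ≡0)
                                                     (ℚP.*-zeroˡ (w · toℚv (A j))))
      ... | no  j≢k  | true  = ℚP.≤-reflexive (trans (cong (toℚ (ℤ.- c j) ℚ.*_)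
                                 (Dual⇒·≡0⇒summand-·≡0 w χ dual 0≤χ (subsetSum-allFirstBut k<M) w·s≡0 j
                                   (cong₂ (λ a b → indicator (a ∧ not b)) fj (dec-false (j Fin.≟ k) j≢k))))
                                 (ℚP.*-zeroʳ (toℚ (ℤ.- c j))))
      ... | no  _    | false = toℚ-neg-*-nonpos (0≤c-rest j fj) (dual j)

module TermCoef {N : ℕ} (M : ℕ) where

  signExp numer denom : (Fin N → ℕ) → ℕ
  signExp l = sumℕ (λ j → if isFirst M j then l j else 0)
  numer   l = prodFact (isFirst M) l
  denom   l = prodFact (λ j → not (isFirst M j)) l

  -- termCoef M l unfolds to signedNumer l / denom l, which is how /-scale applies to it below.
  signedNumer : (Fin N → ℕ) → ℤ
  signedNumer l = (ℤ.- + 1) ℤ.^ signExp l ℤ.* + numer l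

  instance
    denom-nonZero : ∀ {l} → NonZero (denom l)
    denom-nonZero {l} = prodFact-nonZero (λ j → not (isFirst M j)) l

  module _ {k : Fin N} {m : ℕ} {l l′ : Fin N → ℕ}
           (l′≡l : ∀ j → j ≢ k → l′ j ≡ l j) (lₖ≡m : l k ≡ m) (l′ₖ≡1+m : l′ k ≡ suc m) where

    l′ₖ!≡ : l′ k ! ≡ suc m ℕ.* l k !
    l′ₖ!≡ = trans (cong _! l′ₖ≡1+m) (cong (λ x → suc m ℕ.* x !) (sym lₖ≡m))

    termCoef-first : isFirst M k ≡ true → termCoef M l′ ≡ toℚ (ℤ.- + suc m) ℚ.* termCoef M l
    termCoef-first fk = /-scale (ℤ.- + suc m) (signedNumer l′) (signedNumer l) (denom l′) (denom l) cross
      where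
      open ≡-Reasoning
      signExp≡ : signExp l′ ≡ suc (signExp l)
      signExp≡ = sumℕ-update k 1 (λ j j≢k → cong (λ x → if isFirst M j then x else 0) (l′≡l j j≢k))
        (subst (λ b → (if b then l′ k else 0) ≡ 1 ℕ.+ (if b then l k else 0)) (sym fk)
          (trans l′ₖ≡1+m (cong suc (sym lₖ≡m))))
      numer≡ : numer l′ ≡ suc m ℕ.* numer l
      numer≡ = prodFact-update k (isFirst M) (suc m) l′≡l
        (subst (λ b → (if b then l′ k ! else 1) ≡ suc m ℕ.* (if b then l k ! else 1)) (sym fk) l′ₖ!≡)
      denom≡ : denom l′ ≡ denom l
      denom≡ = trans (prodFact-update k (not ∘ isFirst M) 1 l′≡l
        (subst (λ b → (if not b then l′ k ! else 1) ≡ 1 ℕ.* (if not b then l k ! else 1)) (sym fk) refl))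
        (ℕP.*-identityˡ (denom l))
      ring : ∀ a s p d → ((ℤ.- + 1 ℤ.* s) ℤ.* (a ℤ.* p)) ℤ.* d ≡ (ℤ.- a ℤ.* (s ℤ.* p)) ℤ.* d
      ring = solve-∀
      cross : signedNumer l′ ℤ.* + denom l ≡ (ℤ.- + suc m ℤ.* signedNumer l) ℤ.* + denom l′
      cross = begin
        ((ℤ.- + 1) ℤ.^ signExp l′ ℤ.* + numer l′) ℤ.* + denom l
          ≡⟨ cong₂ (λ s p → ((ℤ.- + 1) ℤ.^ s ℤ.* + p) ℤ.* + denom l) signExp≡ numer≡ ⟩
        ((ℤ.- + 1) ℤ.^ suc (signExp l) ℤ.* + (suc m ℕ.* numer l)) ℤ.* + denom l
          ≡⟨ cong (λ p → ((ℤ.- + 1) ℤ.^ suc (signExp l) ℤ.* p) ℤ.* + denom l) (ℤP.pos-* (suc m) (numer l)) ⟩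
        ((ℤ.- + 1 ℤ.* (ℤ.- + 1) ℤ.^ signExp l) ℤ.* (+ suc m ℤ.* + numer l)) ℤ.* + denom l
          ≡⟨ ring (+ suc m) ((ℤ.- + 1) ℤ.^ signExp l) (+ numer l) (+ denom l) ⟩
        (ℤ.- + suc m ℤ.* signedNumer l) ℤ.* + denom l
          ≡⟨ cong (λ d → (ℤ.- + suc m ℤ.* signedNumer l) ℤ.* + d) denom≡ ⟨
        (ℤ.- + suc m ℤ.* signedNumer l) ℤ.* + denom l′
          ∎

    termCoef-rest : isFirst M k ≡ false → termCoef M l ≡ toℚ (+ suc m) ℚ.* termCoef M l′
    termCoef-rest fk = /-scale (+ suc m) (signedNumer l) (signedNumer l′) (denom l) (denom l′) cross
      where
      open ≡-Reasoning
      signExp≡ : signExp l′ ≡ signExp l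
      signExp≡ = sumℕ-update k 0 (λ j j≢k → cong (λ x → if isFirst M j then x else 0) (l′≡l j j≢k))
        (subst (λ b → (if b then l′ k else 0) ≡ 0 ℕ.+ (if b then l k else 0)) (sym fk) refl)
      numer≡ : numer l′ ≡ numer l
      numer≡ = trans (prodFact-update k (isFirst M) 1 l′≡l
        (subst (λ b → (if b then l′ k ! else 1) ≡ 1 ℕ.* (if b then l k ! else 1)) (sym fk) refl))
        (ℕP.*-identityˡ (numer l))
      denom≡ : denom l′ ≡ suc m ℕ.* denom l
      denom≡ = prodFact-update k (not ∘ isFirst M) (suc m) l′≡l
        (subst (λ b → (if not b then l′ k ! else 1) ≡ suc m ℕ.* (if not b then l k ! else 1)) (sym fk) l′ₖ!≡)
      ring : ∀ a x d → x ℤ.* (a ℤ.* d) ≡ (a ℤ.* x) ℤ.* d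
      ring = solve-∀
      cross : signedNumer l ℤ.* + denom l′ ≡ (+ suc m ℤ.* signedNumer l′) ℤ.* + denom l
      cross = begin
        signedNumer l ℤ.* + denom l′
          ≡⟨ cong (λ d → signedNumer l ℤ.* + d) denom≡ ⟩
        signedNumer l ℤ.* + (suc m ℕ.* denom l)
          ≡⟨ cong (signedNumer l ℤ.*_) (ℤP.pos-* (suc m) (denom l)) ⟩
        signedNumer l ℤ.* (+ suc m ℤ.* + denom l)
          ≡⟨ ring (+ suc m) (signedNumer l) (+ denom l) ⟩
        (+ suc m ℤ.* signedNumer l) ℤ.* + denom l
          ≡⟨ cong₂ (λ s p → (+ suc m ℤ.* ((ℤ.- + 1) ℤ.^ s ℤ.* + p)) ℤ.* + denom l) (sym signExp≡) (sym numer≡) ⟩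
        (+ suc m ℤ.* signedNumer l′) ℤ.* + denom l
          ∎

module Series {n N : ℕ} (M : ℕ) (A : Fin N → Vecℤ n)
              (inσ : ∀ j → Dec (InSigma A (betaOf M A) (toℚv (A j)))) where
  open Cone A
  open Face M A
  open TermCoef {N} M

  F : Vecℤ n → Series N
  F = FSeries M A inσ

  InSupport : Vecℤ n → (Fin N → ℤ) → Set
  InSupport u e = (∀ j → + 0 ℤ.≤ lCand M e j)
                × (∀ j → does (inσ j) ≡ false → lNat M e j ≡ 0)
                × (∀ i → lComb M A (lNat M e) i ≡ u i)

  -- The test below is literally the one in FSeries, so that the with-abstraction unfolds F.
  F-cases : ∀ u e → (InSupport u e × F u e ≡ termCoef M (lNat M e)) ⊎ (¬ InSupport u e × F u e ≡ 0ℚ)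
  F-cases u e with FinP.all? (λ j → + 0 ℤ.≤? lCand M e j)
    ×-dec FinP.all? (λ j → (does (inσ j) ≟B false) →-dec (lNat M e j ℕP.≟ 0))
    ×-dec FinP.all? (λ i → lComb M A (lNat M e) i ℤP.≟ u i)
  ... | yes s = inj₁ (s , refl)
  ... | no ¬s = inj₂ (¬s , refl)

  F-support : ∀ {u e} → InSupport u e → F u e ≡ termCoef M (lNat M e)
  F-support {u} {e} s with F-cases u e
  ... | inj₁ (_ , F≡) = F≡
  ... | inj₂ (¬s , _) = ⊥-elim (¬s s)

  F-outside : ∀ {u e} → ¬ InSupport u e → F u e ≡ 0ℚ
  F-outside {u} {e} ¬s with F-cases u e
  ... | inj₁ (s , _)  = ⊥-elim (¬s s)
  ... | inj₂ (_ , F≡) = F≡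

  ¬InSupport-negative : ∀ {u e j m} → lCand M e j ≡ -[1+ m ] → ¬ InSupport u e
  ¬InSupport-negative {j = j} lⱼ≡ (0≤l , _) with subst (+ 0 ℤ.≤_) lⱼ≡ (0≤l j)
  ... | ()

  lCand-first : ∀ {j : Fin N} e → isFirst M j ≡ true → lCand M e j ≡ ℤ.- e j ℤ.- + 1
  lCand-first {j} e fj = cong (λ b → if b then ℤ.- e j ℤ.- + 1 else e j) fj

  lCand-rest : ∀ {j : Fin N} e → isFirst M j ≡ false → lCand M e j ≡ e j
  lCand-rest {j} e fj = cong (λ b → if b then ℤ.- e j ℤ.- + 1 else e j) fj

  lCand-bump-≢ : ∀ {j k : Fin N} e → j ≢ k → lCand M (bump k e) j ≡ lCand M e j
  lCand-bump-≢ {j} e j≢k = cong (λ z → if isFirst M j then ℤ.- z ℤ.- + 1 else z) (bump-≢ e j≢k)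

  lCand-bump-first : ∀ {k : Fin N} e → isFirst M k ≡ true → lCand M e k ≡ + 1 ℤ.+ lCand M (bump k e) k
  lCand-bump-first {k} e fk = begin
    lCand M e k                            ≡⟨ lCand-first e fk ⟩
    ℤ.- e k ℤ.- + 1                        ≡⟨ ring (e k) ⟩
    + 1 ℤ.+ (ℤ.- (e k ℤ.+ + 1) ℤ.- + 1)    ≡⟨ cong (λ z → + 1 ℤ.+ (ℤ.- z ℤ.- + 1)) (bump-≡ k e) ⟨
    + 1 ℤ.+ (ℤ.- bump k e k ℤ.- + 1)       ≡⟨ cong (ℤ._+_ (+ 1)) (lCand-first (bump k e) fk) ⟨
    + 1 ℤ.+ lCand M (bump k e) k           ∎
    where
    open ≡-Reasoning
    ring : ∀ x → ℤ.- x ℤ.- + 1 ≡ + 1 ℤ.+ (ℤ.- (x ℤ.+ + 1) ℤ.- + 1)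
    ring = solve-∀

  factor-first : ∀ {k : Fin N} e → isFirst M k ≡ true → e k ℤ.+ + 1 ≡ ℤ.- (+ 1 ℤ.+ lCand M (bump k e) k)
  factor-first {k} e fk = begin
    e k ℤ.+ + 1                                ≡⟨ ring (e k) ⟩
    ℤ.- (+ 1 ℤ.+ (ℤ.- (e k ℤ.+ + 1) ℤ.- + 1))  ≡⟨ cong (λ z → ℤ.- (+ 1 ℤ.+ (ℤ.- z ℤ.- + 1))) (bump-≡ k e) ⟨
    ℤ.- (+ 1 ℤ.+ (ℤ.- bump k e k ℤ.- + 1))     ≡⟨ cong (λ z → ℤ.- (+ 1 ℤ.+ z)) (lCand-first (bump k e) fk) ⟨
    ℤ.- (+ 1 ℤ.+ lCand M (bump k e) k)         ∎
    where
    open ≡-Reasoning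
    ring : ∀ x → x ℤ.+ + 1 ≡ ℤ.- (+ 1 ℤ.+ (ℤ.- (x ℤ.+ + 1) ℤ.- + 1))
    ring = solve-∀

  factor-rest : ∀ {k : Fin N} e → isFirst M k ≡ false → e k ℤ.+ + 1 ≡ + 1 ℤ.+ lCand M e k
  factor-rest {k} e fk = trans (ℤP.+-comm (e k) (+ 1)) (cong (ℤ._+_ (+ 1)) (sym (lCand-rest e fk)))

  lCand-bump-rest : ∀ {k : Fin N} e → isFirst M k ≡ false → lCand M (bump k e) k ≡ + 1 ℤ.+ lCand M e k
  lCand-bump-rest {k} e fk = trans (lCand-rest (bump k e) fk) (trans (bump-≡ k e) (factor-rest e fk))

  lComb-combination : ∀ e → (∀ j → + 0 ℤ.≤ lCand M e j) → Combination e (lComb M A (lNat M e))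
  lComb-combination e 0≤l i = sumℤ-cong (λ j → cong (ℤ._* A j i) (coefficient j (0≤l j)))
    where
    coefficient : ∀ j → + 0 ℤ.≤ lCand M e j →
                  (if isFirst M j then ℤ.- (+ lNat M e j) ℤ.- + 1 else + lNat M e j) ≡ e j
    coefficient j 0≤lⱼ with isFirst M j
    ... | true  = trans (cong (λ z → ℤ.- z ℤ.- + 1) (ℤP.0≤i⇒+∣i∣≡i 0≤lⱼ)) (ring (e j))
      where
      ring : ∀ x → ℤ.- (ℤ.- x ℤ.- + 1) ℤ.- + 1 ≡ x
      ring = solve-∀
    ... | false = ℤP.0≤i⇒+∣i∣≡i 0≤lⱼ

  lComb-bump : ∀ k e → (∀ j → + 0 ℤ.≤ lCand M e j) → (∀ j → + 0 ℤ.≤ lCand M (bump k e) j) →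
               ∀ i → lComb M A (lNat M (bump k e)) i ≡ A k i ℤ.+ lComb M A (lNat M e) i
  lComb-bump k e 0≤l 0≤l′ i =
    trans (lComb-combination (bump k e) 0≤l′ i) (sym (combination-bump k e (lComb-combination e 0≤l) i))

  module _ {k : Fin N} {e₁ e₂ : Fin N → ℤ} (agree : ∀ j → j ≢ k → lCand M e₂ j ≡ lCand M e₁ j) where

    nonneg-transfer : + 0 ℤ.≤ lCand M e₂ k → (∀ j → + 0 ℤ.≤ lCand M e₁ j) → ∀ j → + 0 ℤ.≤ lCand M e₂ j
    nonneg-transfer 0≤l₂ₖ 0≤l₁ j with j Fin.≟ k
    ... | yes refl = 0≤l₂ₖ
    ... | no  j≢k  = subst (+ 0 ℤ.≤_) (sym (agree j j≢k)) (0≤l₁ j)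

    support-transfer : does (inσ k) ≡ true → (∀ j → does (inσ j) ≡ false → lNat M e₁ j ≡ 0) →
                       ∀ j → does (inσ j) ≡ false → lNat M e₂ j ≡ 0
    support-transfer σₖ supp₁ j σⱼ with j Fin.≟ k
    ... | yes refl with trans (sym σₖ) σⱼ
    ...   | ()
    support-transfer σₖ supp₁ j σⱼ | no j≢k = trans (cong ℤ.∣_∣ (agree j j≢k)) (supp₁ j σⱼ)

  InSupport-bump : ∀ u e k → does (inσ k) ≡ true → + 0 ℤ.≤ lCand M e k → + 0 ℤ.≤ lCand M (bump k e) k →
                   InSupport u (bump k e) ⇔ InSupport (u -v A k) e
  InSupport-bump u e k σₖ 0≤lₖ 0≤l′ₖ = mk⇔
    (λ (0≤l′ , supp′ , l′≡u) →
      let 0≤l = nonneg-transfer (λ j j≢k → sym (lCand-bump-≢ e j≢k)) 0≤lₖ 0≤l′ in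
      0≤l , support-transfer (λ j j≢k → sym (lCand-bump-≢ e j≢k)) σₖ supp′ , λ i →
        trans (sym (xyx⁻¹≈y (A k i) _)) (cong (ℤ._- A k i) (trans (sym (lComb-bump k e 0≤l 0≤l′ i)) (l′≡u i))))
    (λ (0≤l , supp , l≡u-a) →
      let 0≤l′ = nonneg-transfer (λ j j≢k → lCand-bump-≢ e j≢k) 0≤l′ₖ 0≤l in
      0≤l′ , support-transfer (λ j j≢k → lCand-bump-≢ e j≢k) σₖ supp , λ i →
        trans (lComb-bump k e 0≤l 0≤l′ i) (trans (cong (ℤ._+_ (A k i)) (l≡u-a i)) (a+[x-a]≡x (A k i) (u i))))

  InSupport⇒bump-combination : ∀ {u e} k → InSupport (u -v A k) e → Combination (bump k e) u
  InSupport⇒bump-combination {u} {e} k (0≤l , _ , l≡u-a) i =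
    trans (sym (a+[x-a]≡x (A k i) (u i)))
      (trans (cong (ℤ._+_ (A k i)) (sym (l≡u-a i))) (combination-bump k e (lComb-combination e 0≤l) i))

  coefficient-first : ∀ {k l} e → isFirst M k ≡ true → lCand M (bump k e) k ≡ + l →
                      toℚ (e k ℤ.+ + 1) ℚ.* termCoef M (lNat M (bump k e)) ≡ termCoef M (lNat M e)
  coefficient-first {k} {l} e fk l′ₖ≡ =
    trans (cong (λ z → toℚ z ℚ.* termCoef M (lNat M (bump k e))) factor≡)
          (sym (termCoef-first (λ j j≢k → cong ℤ.∣_∣ (sym (lCand-bump-≢ e j≢k)))
                               (cong ℤ.∣_∣ l′ₖ≡) (cong ℤ.∣_∣ lₖ≡) fk))
    where
    factor≡ : e k ℤ.+ + 1 ≡ ℤ.- + suc l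
    factor≡ = trans (factor-first e fk) (cong (λ z → ℤ.- (+ 1 ℤ.+ z)) l′ₖ≡)
    lₖ≡ : lCand M e k ≡ + suc l
    lₖ≡ = trans (lCand-bump-first e fk) (cong (ℤ._+_ (+ 1)) l′ₖ≡)

  coefficient-rest : ∀ {k l} e → isFirst M k ≡ false → lCand M e k ≡ + l →
                     toℚ (e k ℤ.+ + 1) ℚ.* termCoef M (lNat M (bump k e)) ≡ termCoef M (lNat M e)
  coefficient-rest {k} {l} e fk lₖ≡ =
    trans (cong (λ z → toℚ z ℚ.* termCoef M (lNat M (bump k e))) factor≡)
          (sym (termCoef-rest (λ j j≢k → cong ℤ.∣_∣ (lCand-bump-≢ e j≢k))
                              (cong ℤ.∣_∣ lₖ≡) (cong ℤ.∣_∣ l′ₖ≡) fk))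
    where
    factor≡ : e k ℤ.+ + 1 ≡ + suc l
    factor≡ = trans (factor-rest e fk) (cong (ℤ._+_ (+ 1)) lₖ≡)
    l′ₖ≡ : lCand M (bump k e) k ≡ + suc l
    l′ₖ≡ = trans (lCand-bump-rest e fk) (cong (ℤ._+_ (+ 1)) lₖ≡)

  deriv-outside : ∀ u e k → ¬ InSupport u (bump k e) → deriv k (F u) e ≡ 0ℚ
  deriv-outside u e k ¬s = trans (cong (toℚ (e k ℤ.+ + 1) ℚ.*_) (F-outside ¬s)) (ℚP.*-zeroʳ (toℚ (e k ℤ.+ + 1)))

  deriv-factor-zero : ∀ (G : Series N) e k → e k ℤ.+ + 1 ≡ + 0 → deriv k G e ≡ 0ℚ
  deriv-factor-zero G e k eₖ+1≡0 = trans (cong (λ z → toℚ z ℚ.* G (bump k e)) eₖ+1≡0) (ℚP.*-zeroˡ (G (bump k e)))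

  deriv-bump : ∀ u e k → InSupport u (bump k e) ⇔ InSupport (u -v A k) e →
               toℚ (e k ℤ.+ + 1) ℚ.* termCoef M (lNat M (bump k e)) ≡ termCoef M (lNat M e) →
               deriv k (F u) e ≡ F (u -v A k) e
  deriv-bump u e k s⇔ coef with F-cases u (bump k e)
  ... | inj₁ (s , F≡) = trans (cong (toℚ (e k ℤ.+ + 1) ℚ.*_) F≡) (trans coef (sym (F-support (Equivalence.to s⇔ s))))
  ... | inj₂ (¬s , _) = trans (deriv-outside u e k ¬s) (sym (F-outside (¬s ∘ Equivalence.from s⇔)))

  F-first-negative : ∀ {k m} u e → MinimalFor M A → InSigmaInt A β (toℚv (-v u)) → isFirst M k ≡ true →
                     lCand M (bump k e) k ≡ -[1+ m ] → F (u -v A k) e ≡ 0ℚ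
  F-first-negative {k} {suc m} u e _ _ fk l′ₖ≡ =
    F-outside {u -v A k} {e} (¬InSupport-negative (trans (lCand-bump-first e fk) (cong (ℤ._+_ (+ 1)) l′ₖ≡)))
  F-first-negative {k} {zero} u e minimal -u∈σ° fk l′ₖ≡ = F-outside {u -v A k} {e} λ s →
    minimal⇒¬combination {u} (bump k e) minimal -u∈σ° fk (InSupport⇒bump-combination k s) bumpₖ≡0 (0≤bump-rest s)
    where
    bumpₖ≡0 : bump k e k ≡ + 0
    bumpₖ≡0 = trans (bump-≡ k e) (trans (factor-first e fk) (cong (λ z → ℤ.- (+ 1 ℤ.+ z)) l′ₖ≡))
    0≤bump-rest : InSupport (u -v A k) e → ∀ j → isFirst M j ≡ false → + 0 ℤ.≤ bump k e j
    0≤bump-rest (0≤l , _) j fj =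
      subst (+ 0 ℤ.≤_) (trans (lCand-rest e fj) (sym (bump-≢ e (rest≢first fj fk)))) (0≤l j)

  deriv-rest-negative : ∀ {k m} u e → isFirst M k ≡ false → lCand M e k ≡ -[1+ m ] → deriv k (F u) e ≡ 0ℚ
  deriv-rest-negative {k} {zero} u e fk lₖ≡ =
    deriv-factor-zero (F u) e k (trans (factor-rest e fk) (cong (ℤ._+_ (+ 1)) lₖ≡))
  deriv-rest-negative {k} {suc m} u e fk lₖ≡ =
    deriv-outside u e k (¬InSupport-negative (trans (lCand-bump-rest e fk) (cong (ℤ._+_ (+ 1)) lₖ≡)))

  deriv-first : ∀ {u k} → MinimalFor M A → InSigmaInt A β (toℚv (-v u)) → isFirst M k ≡ true →
                ∀ e → deriv k (F u) e ≡ F (u -v A k) e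
  deriv-first {u} {k} minimal -u∈σ° fk e with lCand M (bump k e) k in l′ₖ≡
  ... | + l      = deriv-bump u e k (InSupport-bump u e k σₖ (0≤+ lₖ≡) (0≤+ l′ₖ≡)) (coefficient-first e fk l′ₖ≡)
    where
    σₖ : does (inσ k) ≡ true
    σₖ = dec-true (inσ k) (first-inSigma fk)
    lₖ≡ : lCand M e k ≡ + suc l
    lₖ≡ = trans (lCand-bump-first e fk) (cong (ℤ._+_ (+ 1)) l′ₖ≡)
  ... | -[1+ m ] = trans (deriv-outside u e k (¬InSupport-negative l′ₖ≡))
                         (sym (F-first-negative u e minimal -u∈σ° fk l′ₖ≡))

  deriv-rest : ∀ {u k} → isFirst M k ≡ false → does (inσ k) ≡ true → ∀ e → deriv k (F u) e ≡ F (u -v A k) e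
  deriv-rest {u} {k} fk σₖ e with lCand M e k in lₖ≡
  ... | + l      = deriv-bump u e k (InSupport-bump u e k σₖ (0≤+ lₖ≡) (0≤+ l′ₖ≡)) (coefficient-rest e fk lₖ≡)
    where
    l′ₖ≡ : lCand M (bump k e) k ≡ + suc l
    l′ₖ≡ = trans (lCand-bump-rest e fk) (cong (ℤ._+_ (+ 1)) lₖ≡)
  ... | -[1+ m ] = trans (deriv-rest-negative u e fk lₖ≡) (sym (F-outside {u -v A k} {e} (¬InSupport-negative lₖ≡)))

  deriv-notInSigma : ∀ {u k} → isFirst M k ≡ false → does (inσ k) ≡ false → ∀ e → deriv k (F u) e ≡ 0ℚ
  deriv-notInSigma {u} {k} fk σₖ e with lCand M e k in lₖ≡
  ... | + l      = deriv-outside u e k (λ (_ , supp , _) → ℕP.1+n≢0 (trans (sym (cong ℤ.∣_∣ l′ₖ≡)) (supp k σₖ)))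
    where
    l′ₖ≡ : lCand M (bump k e) k ≡ + suc l
    l′ₖ≡ = trans (lCand-bump-rest e fk) (cong (ℤ._+_ (+ 1)) lₖ≡)
  ... | -[1+ m ] = deriv-rest-negative u e fk lₖ≡

-- The dimension bounds, the normalisation of the last coordinate and u ∈ ℤA are not needed:
-- only −u ∈ σ_β° and the minimality of A′ enter, in the boundary term l_k = 0 for k ≤ M.
lemma2p5 : (n N M : ℕ) → (hn : 1 ≤ n) → 1 ≤ M → M ≤ N →
    (A : Fin N → Vecℤ n) →
    (∀ j → A j (lastIdx hn) ≡ + 1) →
    MinimalFor M A →
    (inσ : ∀ j → Dec (InSigma A (betaOf M A) (toℚv (A j)))) →
    (u : Vecℤ n) → InMβ M A u →
    (k : Fin N) →
      (InSigma A (betaOf M A) (toℚv (A k)) →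
        ∀ e → deriv k (FSeries M A inσ u) e ≡ FSeries M A inσ (u -v A k) e)
      × (¬ InSigma A (betaOf M A) (toℚv (A k)) →
        ∀ e → deriv k (FSeries M A inσ u) e ≡ 0ℚ)
lemma2p5 n N M _ _ _ A _ minimal inσ u (_ , -u∈σ°) k = aₖ∈σ⇒ , aₖ∉σ⇒
  where
  open Face M A using (first-inSigma)
  open Series M A inσ

  aₖ∈σ⇒ : InSigma A (betaOf M A) (toℚv (A k)) → ∀ e → deriv k (F u) e ≡ F (u -v A k) e
  aₖ∈σ⇒ aₖ∈σ with isFirst M k in fk
  ... | true  = deriv-first minimal -u∈σ° fk
  ... | false = deriv-rest fk (dec-true (inσ k) aₖ∈σ)

  aₖ∉σ⇒ : ¬ InSigma A (betaOf M A) (toℚv (A k)) → ∀ e → deriv k (F u) e ≡ 0ℚ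
  aₖ∉σ⇒ aₖ∉σ with isFirst M k in fk
  ... | true  = ⊥-elim (aₖ∉σ (first-inSigma fk))
  ... | false = deriv-notInSigma fk (dec-false (inσ k) aₖ∉σ)
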